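{- Let $\phi$ be a satisfiable $\mathbf{Gr}(\mathbf{K}_\mathcal{R})$-formula in negation normal form. Then there is a sequence of applications of the optimised rules starting with $\{x_0\models\phi\}$ that results in a complete and clash-free constraint system.
   Context: Formulae in NNF: $p$, $\neg p$, $\psi_1\wedge\psi_2$, $\psi_1\vee\psi_2$, $\langle R\rangle_{\ge n}\psi$, $\langle R\rangle_{\le n}\psi$ (at least / at most $n$ $R$-successors satisfy $\psi$). $\sim\psi$ is the NNF of $\neg\psi$ (De Morgan, $\neg\langle R\rangle_{\ge 0}\psi\equiv p\wedge\neg p$, $\neg\langle R\rangle_{\ge n}\psi\equiv\langle R\rangle_{\le n-1}\psi$ for $n\ge1$, $\neg\langle R\rangle_{\le n}\psi\equiv\langle R\rangle_{\ge n+1}\psi$). A constraint system (c.s.) is a finite set of expressions $x\models\psi$ and $Rxy$ over variables; $\sharp R^S(x,\psi)=|\{y:\{Rxy,y\models\psi\}\subseteq S\}|$. Optimised rules: ($\wedge$) if $x\models\psi_1\wedge\psi_2\in S$ and not both $x\models\psi_1,x\models\psi_2\in S$, add both; ($\vee$) if $x\models\psi_1\vee\psi_2\in S$ and neither disjunct constraint is in $S$, add $x\models\chi$ for a chosen $\chi\in\{\psi_1,\psi_2\}$; ($\ge$) if $x\models\langle R\rangle_{\ge n}\psi\in S$, $\sharp R^S(x,\psi)<n$, and neither the $\wedge$- nor $\vee$-rule applies to a constraint for $x$, add $Rxy$, $y\models\psi$, $y\models\chi_1,\dots,y\models\chi_k$ for a fresh $y$, where $\{\psi_1,\dots,\psi_k\}=\{\psi':x\models\langle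 R\rangle_{\bowtie m}\psi'\in S,\ \bowtie\in\{\le,\ge\}\}$ and each $\chi_i\in\{\psi_i,\sim\psi_i\}$ chosen nondeterministically. A c.s. is complete if no rule applies. It contains a clash if $\{x\models p,x\models\neg p\}\subseteq S$ for some $x$ and atom $p$, or $x\models\langle R\rangle_{\le n}\psi\in S$ and $\sharp R^S(x,\psi)>n$; otherwise it is clash-free. -}

module Defs where

open import Data.Nat as ℕ using (ℕ; zero; suc; _<_; _>_)
open import Data.Fin using (Fin)
open import Data.Product using (Σ; ∃; ∃-syntax; _×_; _,_)
open import Data.Sum using (_⊎_)
open import Data.List using (List; []; _∷_; _++_; length; map; filter; deduplicate; concatMap)
open import Data.List.Relation.Binary.Pointwise using (Pointwise)
open import Data.Empty using (⊥)
open import Relation.Nullary using (¬_; Dec; yes; no)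
open import Relation.Nullary.Decidable using (map′; _×-dec_)
open import Relation.Binary.Definitions using (DecidableEquality)
open import Relation.Binary.PropositionalEquality using (_≡_; refl; cong)
open import Relation.Binary.Construct.Closure.ReflexiveTransitive using (Star)
open import Function.Definitions using (Injective)

Atom : Set
Atom = ℕ

RelName : Set
RelName = ℕ

Var : Set
Var = ℕ

infixr 6 _∧_
infixr 5 _∨_

data Formula : Set where
  var     : Atom → Formula
  neg     : Atom → Formula
  _∧_     : Formula → Formula → Formula
  _∨_     : Formula → Formula → Formula
  ⟨_⟩≥_∙_ : RelName → ℕ → Formula → Formula
  ⟨_⟩≤_∙_ : RelName → ℕ → Formula → Formula

-- ∼ψ : the NNF of ¬ψ.  (p ∧ ¬p is instantiated with the atom 0.)
∼_ : Formula → Formula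
∼ var p           = neg p
∼ neg p           = var p
∼ (a ∧ b)         = (∼ a) ∨ (∼ b)
∼ (a ∨ b)         = (∼ a) ∧ (∼ b)
∼ (⟨ r ⟩≥ zero ∙ a)  = var 0 ∧ neg 0
∼ (⟨ r ⟩≥ suc n ∙ a) = ⟨ r ⟩≤ n ∙ a
∼ (⟨ r ⟩≤ n ∙ a)     = ⟨ r ⟩≥ suc n ∙ a

_≟F_ : DecidableEquality Formula
(var p₁) ≟F (var p₂) = map′ (cong var) (λ { refl → refl }) (p₁ ℕ.≟ p₂)
(neg p₁) ≟F (neg p₂) = map′ (cong neg) (λ { refl → refl }) (p₁ ℕ.≟ p₂)
(a₁ ∧ b₁) ≟F (a₂ ∧ b₂) = map′ (λ { (refl , refl) → refl }) (λ { refl → refl , refl }) ((a₁ ≟F a₂) ×-dec (b₁ ≟F b₂))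
(a₁ ∨ b₁) ≟F (a₂ ∨ b₂) = map′ (λ { (refl , refl) → refl }) (λ { refl → refl , refl }) ((a₁ ≟F a₂) ×-dec (b₁ ≟F b₂))
(⟨ r₁ ⟩≥ n₁ ∙ a₁) ≟F (⟨ r₂ ⟩≥ n₂ ∙ a₂) = map′ (λ { (refl , refl , refl) → refl }) (λ { refl → refl , refl , refl }) ((r₁ ℕ.≟ r₂) ×-dec ((n₁ ℕ.≟ n₂) ×-dec (a₁ ≟F a₂)))
(⟨ r₁ ⟩≤ n₁ ∙ a₁) ≟F (⟨ r₂ ⟩≤ n₂ ∙ a₂) = map′ (λ { (refl , refl , refl) → refl }) (λ { refl → refl , refl , refl }) ((r₁ ℕ.≟ r₂) ×-dec ((n₁ ℕ.≟ n₂) ×-dec (a₁ ≟F a₂)))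
(var p₁) ≟F (neg p₂) = no (λ ())
(var p₁) ≟F (a₂ ∧ b₂) = no (λ ())
(var p₁) ≟F (a₂ ∨ b₂) = no (λ ())
(var p₁) ≟F (⟨ r₂ ⟩≥ n₂ ∙ a₂) = no (λ ())
(var p₁) ≟F (⟨ r₂ ⟩≤ n₂ ∙ a₂) = no (λ ())
(neg p₁) ≟F (var p₂) = no (λ ())
(neg p₁) ≟F (a₂ ∧ b₂) = no (λ ())
(neg p₁) ≟F (a₂ ∨ b₂) = no (λ ())
(neg p₁) ≟F (⟨ r₂ ⟩≥ n₂ ∙ a₂) = no (λ ())
(neg p₁) ≟F (⟨ r₂ ⟩≤ n₂ ∙ a₂) = no (λ ())
(a₁ ∧ b₁) ≟F (var p₂) = no (λ ())
(a₁ ∧ b₁) ≟F (neg p₂) = no (λ ())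
(a₁ ∧ b₁) ≟F (a₂ ∨ b₂) = no (λ ())
(a₁ ∧ b₁) ≟F (⟨ r₂ ⟩≥ n₂ ∙ a₂) = no (λ ())
(a₁ ∧ b₁) ≟F (⟨ r₂ ⟩≤ n₂ ∙ a₂) = no (λ ())
(a₁ ∨ b₁) ≟F (var p₂) = no (λ ())
(a₁ ∨ b₁) ≟F (neg p₂) = no (λ ())
(a₁ ∨ b₁) ≟F (a₂ ∧ b₂) = no (λ ())
(a₁ ∨ b₁) ≟F (⟨ r₂ ⟩≥ n₂ ∙ a₂) = no (λ ())
(a₁ ∨ b₁) ≟F (⟨ r₂ ⟩≤ n₂ ∙ a₂) = no (λ ())
(⟨ r₁ ⟩≥ n₁ ∙ a₁) ≟F (var p₂) = no (λ ())
(⟨ r₁ ⟩≥ n₁ ∙ a₁) ≟F (neg p₂) = no (λ ())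
(⟨ r₁ ⟩≥ n₁ ∙ a₁) ≟F (a₂ ∧ b₂) = no (λ ())
(⟨ r₁ ⟩≥ n₁ ∙ a₁) ≟F (a₂ ∨ b₂) = no (λ ())
(⟨ r₁ ⟩≥ n₁ ∙ a₁) ≟F (⟨ r₂ ⟩≤ n₂ ∙ a₂) = no (λ ())
(⟨ r₁ ⟩≤ n₁ ∙ a₁) ≟F (var p₂) = no (λ ())
(⟨ r₁ ⟩≤ n₁ ∙ a₁) ≟F (neg p₂) = no (λ ())
(⟨ r₁ ⟩≤ n₁ ∙ a₁) ≟F (a₂ ∧ b₂) = no (λ ())
(⟨ r₁ ⟩≤ n₁ ∙ a₁) ≟F (a₂ ∨ b₂) = no (λ ())
(⟨ r₁ ⟩≤ n₁ ∙ a₁) ≟F (⟨ r₂ ⟩≥ n₂ ∙ a₂) = no (λ ())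

record Model : Set₁ where
  field
    W   : Set
    Acc : RelName → W → W → Set
    Val : Atom → W → Set
open Model public

_,_⊩_ : (M : Model) → W M → Formula → Set
M , w ⊩ var p = Val M p w
M , w ⊩ neg p = ¬ Val M p w
M , w ⊩ (a ∧ b) = (M , w ⊩ a) × (M , w ⊩ b)
M , w ⊩ (a ∨ b) = (M , w ⊩ a) ⊎ (M , w ⊩ b)
M , w ⊩ (⟨ r ⟩≥ n ∙ a) =
  Σ (Fin n → W M) λ f → Injective _≡_ _≡_ f × (∀ i → Acc M r w (f i) × (M , f i ⊩ a))
M , w ⊩ (⟨ r ⟩≤ n ∙ a) =
  ¬ (Σ (Fin (suc n) → W M) λ f → Injective _≡_ _≡_ f × (∀ i → Acc M r w (f i) × (M , f i ⊩ a)))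

Satisfiable : Formula → Set₁
Satisfiable φ = Σ Model λ M → Σ (W M) λ w → M , w ⊩ φ

infix 4 _⊨_

data Constraint : Set where
  _⊨_ : Var → Formula → Constraint
  rel : RelName → Var → Var → Constraint

_≟C_ : DecidableEquality Constraint
(x₁ ⊨ a₁) ≟C (x₂ ⊨ a₂) = map′ (λ { (refl , refl) → refl }) (λ { refl → refl , refl }) ((x₁ ℕ.≟ x₂) ×-dec (a₁ ≟F a₂))
(rel r₁ x₁ y₁) ≟C (rel r₂ x₂ y₂) = map′ (λ { (refl , refl , refl) → refl }) (λ { refl → refl , refl , refl }) ((r₁ ℕ.≟ r₂) ×-dec ((x₁ ℕ.≟ x₂) ×-dec (y₁ ℕ.≟ y₂)))
(_ ⊨ _) ≟C (rel _ _ _) = no (λ ())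
(rel _ _ _) ≟C (_ ⊨ _) = no (λ ())

-- A constraint system is a finite set, represented by a list (order and
-- multiplicity are irrelevant: only membership is ever used).
CS : Set
CS = List Constraint

open import Data.List.Membership.DecPropositional _≟C_ using (_∈_; _∉_; _∈?_)
open import Data.List.Membership.DecPropositional ℕ._≟_ as ℕMem using ()

varsC : Constraint → List Var
varsC (x ⊨ _)     = x ∷ []
varsC (rel _ x y) = x ∷ y ∷ []

Fresh : Var → CS → Set
Fresh y S = y ℕMem.∉ concatMap varsC S

succs : CS → RelName → Var → List Var
succs [] r x = []
succs ((_ ⊨ _) ∷ S) r x = succs S r x
succs (rel r' x' y ∷ S) r x with (r' ℕ.≟ r) ×-dec (x' ℕ.≟ x)
... | yes _ = y ∷ succs S r x
... | no  _ = succs S r x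

count : CS → RelName → Var → Formula → ℕ
count S r x ψ = length (filter (λ y → (y ⊨ ψ) ∈? S) (deduplicate ℕ._≟_ (succs S r x)))

modalFs : CS → RelName → Var → List Formula
modalFs S r x = deduplicate _≟F_ (go S)
  where
  pick : Formula → List Formula
  pick (⟨ r' ⟩≥ _ ∙ a) with r' ℕ.≟ r
  ... | yes _ = a ∷ []
  ... | no  _ = []
  pick (⟨ r' ⟩≤ _ ∙ a) with r' ℕ.≟ r
  ... | yes _ = a ∷ []
  ... | no  _ = []
  pick _ = []
  go : CS → List Formula
  go [] = []
  go ((x' ⊨ a) ∷ S') with x' ℕ.≟ x
  ... | yes _ = pick a ++ go S'
  ... | no  _ = go S'
  go (rel _ _ _ ∷ S') = go S'

AndApplicable : CS → Var → Set
AndApplicable S x = ∃[ a ] ∃[ b ] ((x ⊨ a ∧ b) ∈ S × ¬ ((x ⊨ a) ∈ S × (x ⊨ b) ∈ S))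

OrApplicable : CS → Var → Set
OrApplicable S x = ∃[ a ] ∃[ b ] ((x ⊨ a ∨ b) ∈ S × (x ⊨ a) ∉ S × (x ⊨ b) ∉ S)

data Step : CS → CS → Set where
  ∧-rule : ∀ {S x a b} →
    (x ⊨ a ∧ b) ∈ S → ¬ ((x ⊨ a) ∈ S × (x ⊨ b) ∈ S) →
    Step S ((x ⊨ a) ∷ (x ⊨ b) ∷ S)
  ∨-rule : ∀ {S x a b χ} →
    (x ⊨ a ∨ b) ∈ S → (x ⊨ a) ∉ S → (x ⊨ b) ∉ S →
    (χ ≡ a ⊎ χ ≡ b) →
    Step S ((x ⊨ χ) ∷ S)
  ≥-rule : ∀ {S x r n a y} (χs : List Formula) →
    (x ⊨ ⟨ r ⟩≥ n ∙ a) ∈ S → count S r x a < n →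
    ¬ AndApplicable S x → ¬ OrApplicable S x →
    Fresh y S →
    Pointwise (λ ψ χ → χ ≡ ψ ⊎ χ ≡ ∼ ψ) (modalFs S r x) χs →
    Step S (rel r x y ∷ (y ⊨ a) ∷ (map (y ⊨_) χs ++ S))

Complete : CS → Set
Complete S = ∀ S' → ¬ Step S S'

Clash : CS → Set
Clash S =
  (∃[ x ] ∃[ p ] ((x ⊨ var p) ∈ S × (x ⊨ neg p) ∈ S))
  ⊎ (∃[ x ] ∃[ r ] ∃[ n ] ∃[ a ] ((x ⊨ ⟨ r ⟩≤ n ∙ a) ∈ S × count S r x a > n))

ClashFree : CS → Set
ClashFree S = ¬ Clash S

Steps : CS → CS → Set
Steps = Star Step

initial : Formula → CS
initial φ = (0 ⊨ φ) ∷ []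

module Submission where

-- The tableau strategy (saturate a variable with the ∧- and ∨-rules, then meet each of its
-- ⟨R⟩≥ constraints with fresh successors, each expanded recursively at smaller modal depth)
-- is run as a finitely branching nondeterministic computation; every outcome is complete.
-- A model of φ singles out a branch, followed classically: map each variable to a world so
-- that all constraints hold, R-successors of the same variable go to distinct worlds, and a
-- successor carries ψ (rather than ∼ψ) exactly when its world satisfies ψ.  The outcome of
-- that branch is clash-free.  This only shows that not all outcomes clash, but clashes are
-- decidable and outcomes finitely many, so a clash-free outcome can be found constructively.

open import Defs
open import Data.Product as Product using (Σ; _×_; _,_; proj₁; proj₂; ∃-syntax)
open import Data.Sum as Sum using (_⊎_; inj₁; inj₂)
open import Data.Empty using (⊥; ⊥-elim)
open import Data.Unit using (⊤)
open import Data.Nat as ℕ using (ℕ; zero; suc; _+_; _≤_; _<_; _⊔_; z≤n; s≤s)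
import Data.Nat.Properties as ℕₚ
open import Data.Fin as Fin using (Fin)
import Data.Fin.Properties as Finₚ
open import Data.List using (List; []; _∷_; _++_; length; map; filter; deduplicate; lookup)
open import Data.List.Properties using (length-map)
open import Data.List.Membership.Propositional using (_∈_; _∉_; find; lose)
open import Data.List.Membership.DecPropositional _≟C_ using (_∈?_)
open import Data.List.Membership.Propositional.Properties
  using (∈-++⁺ˡ; ∈-++⁺ʳ; ∈-++⁻; ∈-map⁺; ∈-map⁻; ∈-concatMap⁻;
         ∈-filter⁺; ∈-filter⁻; ∈-deduplicate⁺; ∈-deduplicate⁻; ∈-lookup)
open import Data.List.Relation.Unary.Any using (Any; here; there; index; any?)
open import Data.List.Relation.Unary.Any.Properties using (lookup-index)
open import Data.List.Relation.Unary.All as All using (All; []; _∷_)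
open import Data.List.Relation.Unary.AllPairs using (_∷_)
open import Data.List.Relation.Unary.Unique.Propositional using (Unique)
import Data.List.Relation.Unary.Unique.Propositional.Properties as Unique
open import Data.List.Relation.Unary.Unique.DecPropositional.Properties using (deduplicate-!)
open import Data.List.Relation.Binary.Subset.Propositional using (_⊆_)
open import Data.List.Relation.Binary.Pointwise using (Pointwise; []; _∷_)
open import Relation.Nullary using (¬_; ¬?; Dec; yes; no; _×-dec_; _⊎-dec_; ¬¬-excluded-middle)
open import Relation.Nullary.Decidable using (map′; decidable-stable)
open import Relation.Nullary.Negation using (¬¬-Monad)
open import Effect.Monad using (RawMonad)
open import Function using (_∘_; id; case_of_)
open import Function.Definitions using (Injective)
open import Relation.Binary.Construct.Closure.ReflexiveTransitive using (ε; _◅_; _◅◅_)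
open import Relation.Binary.PropositionalEquality
  using (_≡_; _≢_; refl; sym; trans; cong; subst; subst₂; module ≡-Reasoning)

private
  variable
    A B : Set

-- Successors and counting

GradedAt : CS → RelName → Var → Formula → Set
GradedAt S r x ψ = ∃[ n ] ((x ⊨ ⟨ r ⟩≥ n ∙ ψ) ∈ S ⊎ (x ⊨ ⟨ r ⟩≤ n ∙ ψ) ∈ S)

gradedAt-∷ : ∀ {c S r x ψ} → GradedAt S r x ψ → GradedAt (c ∷ S) r x ψ
gradedAt-∷ (n , inj₁ p) = n , inj₁ (there p)
gradedAt-∷ (n , inj₂ p) = n , inj₂ (there p)

∈-modalFs-∷ : ∀ c S {r x ψ} → ψ ∈ modalFs S r x → ψ ∈ modalFs (c ∷ S) r x
∈-modalFs-∷ (x' ⊨ a) S {x = x} p with x' ℕ.≟ x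
... | yes _ = ∈-deduplicate⁺ _≟F_ (∈-++⁺ʳ _ (∈-deduplicate⁻ _≟F_ _ p))
... | no _ = p
∈-modalFs-∷ (rel _ _ _) S p = p

∈-modalFs⁺ : ∀ S {r x ψ} → GradedAt S r x ψ → ψ ∈ modalFs S r x
∈-modalFs⁺ (.(x ⊨ ⟨ r ⟩≥ n ∙ ψ) ∷ S) {r} {x} {ψ} (n , inj₁ (here refl)) with x ℕ.≟ x
... | no x≢x = ⊥-elim (x≢x refl)
... | yes _ with r ℕ.≟ r
...   | yes _ = here refl
...   | no r≢r = ⊥-elim (r≢r refl)
∈-modalFs⁺ (.(x ⊨ ⟨ r ⟩≤ n ∙ ψ) ∷ S) {r} {x} {ψ} (n , inj₂ (here refl)) with x ℕ.≟ x
... | no x≢x = ⊥-elim (x≢x refl)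
... | yes _ with r ℕ.≟ r
...   | yes _ = here refl
...   | no r≢r = ⊥-elim (r≢r refl)
∈-modalFs⁺ (c ∷ S) (n , inj₁ (there p)) = ∈-modalFs-∷ c S (∈-modalFs⁺ S (n , inj₁ p))
∈-modalFs⁺ (c ∷ S) (n , inj₂ (there p)) = ∈-modalFs-∷ c S (∈-modalFs⁺ S (n , inj₂ p))

∈-modalFs⁻ : ∀ S {r x ψ} → ψ ∈ modalFs S r x → GradedAt S r x ψ
∈-modalFs⁻ [] ()
∈-modalFs⁻ (rel _ _ _ ∷ S) p = gradedAt-∷ (∈-modalFs⁻ S p)
∈-modalFs⁻ ((x' ⊨ a) ∷ S) {x = x} p with x' ℕ.≟ x
... | no _ = gradedAt-∷ (∈-modalFs⁻ S p)
∈-modalFs⁻ ((_ ⊨ var _) ∷ S) p | yes _ = gradedAt-∷ (∈-modalFs⁻ S p)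
∈-modalFs⁻ ((_ ⊨ neg _) ∷ S) p | yes _ = gradedAt-∷ (∈-modalFs⁻ S p)
∈-modalFs⁻ ((_ ⊨ _ ∧ _) ∷ S) p | yes _ = gradedAt-∷ (∈-modalFs⁻ S p)
∈-modalFs⁻ ((_ ⊨ _ ∨ _) ∷ S) p | yes _ = gradedAt-∷ (∈-modalFs⁻ S p)
∈-modalFs⁻ ((_ ⊨ ⟨ r' ⟩≥ n ∙ b) ∷ S) {r} p | yes refl with r' ℕ.≟ r
... | no _ = gradedAt-∷ (∈-modalFs⁻ S p)
... | yes refl with ∈-deduplicate⁻ _≟F_ _ p
...   | here refl = n , inj₁ (here refl)
...   | there q = gradedAt-∷ (∈-modalFs⁻ S (∈-deduplicate⁺ _≟F_ q))
∈-modalFs⁻ ((_ ⊨ ⟨ r' ⟩≤ n ∙ b) ∷ S) {r} p | yes refl with r' ℕ.≟ r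
... | no _ = gradedAt-∷ (∈-modalFs⁻ S p)
... | yes refl with ∈-deduplicate⁻ _≟F_ _ p
...   | here refl = n , inj₂ (here refl)
...   | there q = gradedAt-∷ (∈-modalFs⁻ S (∈-deduplicate⁺ _≟F_ q))

∈-succs⁺ : ∀ S {r x y} → rel r x y ∈ S → y ∈ succs S r x
∈-succs⁺ (.(rel r x y) ∷ S) {r} {x} {y} (here refl) with (r ℕ.≟ r) ×-dec (x ℕ.≟ x)
... | yes _ = here refl
... | no ≢ = ⊥-elim (≢ (refl , refl))
∈-succs⁺ ((_ ⊨ _) ∷ S) (there p) = ∈-succs⁺ S p
∈-succs⁺ (rel r' x' _ ∷ S) {r} {x} (there p) with (r' ℕ.≟ r) ×-dec (x' ℕ.≟ x)
... | yes _ = there (∈-succs⁺ S p)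
... | no _ = ∈-succs⁺ S p

∈-succs⁻ : ∀ S {r x y} → y ∈ succs S r x → rel r x y ∈ S
∈-succs⁻ ((_ ⊨ _) ∷ S) p = there (∈-succs⁻ S p)
∈-succs⁻ (rel r' x' _ ∷ S) {r} {x} p with (r' ℕ.≟ r) ×-dec (x' ℕ.≟ x)
∈-succs⁻ (rel r' x' _ ∷ S) (here refl) | yes (refl , refl) = here refl
∈-succs⁻ (rel r' x' _ ∷ S) (there p)   | yes _ = there (∈-succs⁻ S p)
... | no _ = there (∈-succs⁻ S p)

counted : CS → RelName → Var → Formula → List Var
counted S r x a = filter (λ y → (y ⊨ a) ∈? S) (deduplicate ℕ._≟_ (succs S r x))

∈-counted⁻ : ∀ S {r x a y} → y ∈ counted S r x a → rel r x y ∈ S × (y ⊨ a) ∈ S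
∈-counted⁻ S {r} {x} {a} p =
  let y∈succs , y⊨a = ∈-filter⁻ (λ y → (y ⊨ a) ∈? S) p
  in ∈-succs⁻ S (∈-deduplicate⁻ ℕ._≟_ (succs S r x) y∈succs) , y⊨a

∈-counted⁺ : ∀ S {r x a y} → rel r x y ∈ S → (y ⊨ a) ∈ S → y ∈ counted S r x a
∈-counted⁺ S {a = a} Rxy y⊨a =
  ∈-filter⁺ (λ y → (y ⊨ a) ∈? S) (∈-deduplicate⁺ ℕ._≟_ (∈-succs⁺ S Rxy)) y⊨a

counted-unique : ∀ S r x a → Unique (counted S r x a)
counted-unique S r x a = Unique.filter⁺ (λ y → (y ⊨ a) ∈? S) (deduplicate-! ℕ._≟_ (succs S r x))

lookup-injective : ∀ {xs : List A} → Unique xs → Injective _≡_ _≡_ (lookup xs)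
lookup-injective (_ ∷ _) {Fin.zero} {Fin.zero} _ = refl
lookup-injective (x∉ ∷ _) {Fin.zero} {Fin.suc j} e = ⊥-elim (All.lookup x∉ (∈-lookup j) e)
lookup-injective (x∉ ∷ _) {Fin.suc i} {Fin.zero} e = ⊥-elim (All.lookup x∉ (∈-lookup i) (sym e))
lookup-injective (_ ∷ u) {Fin.suc i} {Fin.suc j} e = cong Fin.suc (lookup-injective u e)

unique-⊆⇒length≤ : ∀ {xs ys : List A} → Unique xs → xs ⊆ ys → length xs ≤ length ys
unique-⊆⇒length≤ {xs = xs} {ys} u xs⊆ys = Finₚ.injective⇒≤ position-injective
  where
  position : Fin (length xs) → Fin (length ys)
  position i = index (xs⊆ys (∈-lookup i))
  position-injective : Injective _≡_ _≡_ position
  position-injective {i} {j} e = lookup-injective u (begin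
    lookup xs i             ≡⟨ lookup-index (xs⊆ys (∈-lookup i)) ⟩
    lookup ys (position i)  ≡⟨ cong (lookup ys) e ⟩
    lookup ys (position j)  ≡⟨ lookup-index (xs⊆ys (∈-lookup j)) ⟨
    lookup xs j             ∎)
    where open ≡-Reasoning

count-mono : ∀ {S S'} → S ⊆ S' → ∀ r x a → count S r x a ≤ count S' r x a
count-mono {S} {S'} S⊆S' r x a = unique-⊆⇒length≤ (counted-unique S r x a) λ y∈ →
  let Rxy , y⊨a = ∈-counted⁻ S y∈ in ∈-counted⁺ S' (S⊆S' Rxy) (S⊆S' y⊨a)

depth : Formula → ℕ
depth (var _) = 0
depth (neg _) = 0
depth (a ∧ b) = depth a ⊔ depth b
depth (a ∨ b) = depth a ⊔ depth b
depth (⟨ _ ⟩≥ _ ∙ a) = suc (depth a)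
depth (⟨ _ ⟩≤ _ ∙ a) = suc (depth a)

depth-∼ : ∀ ψ → depth (∼ ψ) ≤ depth ψ
depth-∼ (var _) = z≤n
depth-∼ (neg _) = z≤n
depth-∼ (a ∧ b) = ℕₚ.⊔-mono-≤ (depth-∼ a) (depth-∼ b)
depth-∼ (a ∨ b) = ℕₚ.⊔-mono-≤ (depth-∼ a) (depth-∼ b)
depth-∼ (⟨ _ ⟩≥ zero ∙ a) = z≤n
depth-∼ (⟨ _ ⟩≥ suc n ∙ a) = ℕₚ.≤-refl
depth-∼ (⟨ _ ⟩≤ _ ∙ a) = ℕₚ.≤-refl

depth-⊔ˡ : ∀ a b {D} → depth a ⊔ depth b < D → depth a < D
depth-⊔ˡ a b = ℕₚ.≤-<-trans (ℕₚ.m≤m⊔n (depth a) (depth b))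

depth-⊔ʳ : ∀ a b {D} → depth a ⊔ depth b < D → depth b < D
depth-⊔ʳ a b = ℕₚ.≤-<-trans (ℕₚ.m≤n⊔m (depth a) (depth b))

-- Nondeterministic computations

infixl 1 _>>=_
infixr 2 _⊕_

data ND (A : Set) : Set where
  return : A → ND A
  _⊕_    : ND A → ND A → ND A

_>>=_ : ND A → (A → ND B) → ND B
return a >>= f = f a
(l ⊕ r) >>= f = (l >>= f) ⊕ (r >>= f)

Outcome : (A → Set) → ND A → Set
Outcome P (return a) = P a
Outcome P (l ⊕ r) = Outcome P l ⊎ Outcome P r

outcome? : {P : A → Set} → (∀ a → Dec (P a)) → ∀ t → Dec (Outcome P t)
outcome? P? (return a) = P? a
outcome? P? (l ⊕ r) = outcome? P? l ⊎-dec outcome? P? r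

outcome-witness : {P : A → Set} → ∀ t → Outcome P t → Σ A P
outcome-witness (return a) p = a , p
outcome-witness (l ⊕ r) (inj₁ p) = outcome-witness l p
outcome-witness (l ⊕ r) (inj₂ p) = outcome-witness r p

outcome-map : {P Q : A → Set} → (∀ {a} → P a → Q a) → ∀ t → Outcome P t → Outcome Q t
outcome-map f (return a) p = f p
outcome-map f (l ⊕ r) = Sum.map (outcome-map f l) (outcome-map f r)

record ◇ (P : A → Set) (t : ND A) : Set where
  constructor box
  field unbox : ¬ ¬ Outcome P t

open ◇

◇-return : {P : A → Set} {a : A} → P a → ◇ P (return a)
◇-return p = box λ ¬p → ¬p p

◇-left : {P : A → Set} {l r : ND A} → ◇ P l → ◇ P (l ⊕ r)
◇-left (box ¬¬p) = box λ ¬p → ¬¬p (¬p ∘ inj₁)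

◇-right : {P : A → Set} {l r : ND A} → ◇ P r → ◇ P (l ⊕ r)
◇-right (box ¬¬p) = box λ ¬p → ¬¬p (¬p ∘ inj₂)

◇-stable : {P : A → Set} {t : ND A} → ¬ ¬ ◇ P t → ◇ P t
◇-stable ¬¬◇ = box λ ¬p → ¬¬◇ λ ◇p → unbox ◇p ¬p

◇-map : {P Q : A → Set} → (∀ {a} → P a → Q a) → ∀ {t} → ◇ P t → ◇ Q t
◇-map f {t} (box ¬¬p) = box λ ¬q → ¬¬p (¬q ∘ outcome-map f t)

◇-bind : {P : A → Set} {Q : B → Set} {t : ND A} {f : A → ND B} →
         ◇ P t → (∀ {a} → P a → ◇ Q (f a)) → ◇ Q (t >>= f)
◇-bind {P = P} {Q} {t} {f} (box ¬¬p) k = box λ ¬q → ¬¬p λ p → unbox (outcome-bind t p) ¬q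
  where
  outcome-bind : ∀ t → Outcome P t → ◇ Q (t >>= f)
  outcome-bind (return a) p = k p
  outcome-bind (l ⊕ r) (inj₁ p) = ◇-left (outcome-bind l p)
  outcome-bind (l ⊕ r) (inj₂ p) = ◇-right (outcome-bind r p)

Unfolded : CS → Var → Formula → Set
Unfolded S x (a ∧ b) = (x ⊨ a) ∈ S × (x ⊨ b) ∈ S
Unfolded S x (a ∨ b) = (x ⊨ a) ∈ S ⊎ (x ⊨ b) ∈ S
Unfolded S x _ = ⊤

Fulfilled : CS → Var → Formula → Set
Fulfilled S x (⟨ r ⟩≥ n ∙ a) = n ≤ count S r x a
Fulfilled S x _ = ⊤

Expanded : CS → Var → Formula → Set
Expanded S x ψ = Unfolded S x ψ × Fulfilled S x ψ

unfolded-mono : ∀ {S S'} → S ⊆ S' → ∀ {x} ψ → Unfolded S x ψ → Unfolded S' x ψ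
unfolded-mono S⊆S' (a ∧ b) = Product.map S⊆S' S⊆S'
unfolded-mono S⊆S' (a ∨ b) = Sum.map S⊆S' S⊆S'
unfolded-mono S⊆S' (var _) = _
unfolded-mono S⊆S' (neg _) = _
unfolded-mono S⊆S' (⟨ _ ⟩≥ _ ∙ _) = _
unfolded-mono S⊆S' (⟨ _ ⟩≤ _ ∙ _) = _

fulfilled-mono : ∀ {S S'} → S ⊆ S' → ∀ {x} ψ → Fulfilled S x ψ → Fulfilled S' x ψ
fulfilled-mono S⊆S' {x} (⟨ r ⟩≥ n ∙ a) n≤ = ℕₚ.≤-trans n≤ (count-mono S⊆S' r x a)
fulfilled-mono S⊆S' (var _) = _
fulfilled-mono S⊆S' (neg _) = _
fulfilled-mono S⊆S' (_ ∧ _) = _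
fulfilled-mono S⊆S' (_ ∨ _) = _
fulfilled-mono S⊆S' (⟨ _ ⟩≤ _ ∙ _) = _

expanded-mono : ∀ {S S'} → S ⊆ S' → ∀ {x} ψ → Expanded S x ψ → Expanded S' x ψ
expanded-mono S⊆S' ψ = Product.map (unfolded-mono S⊆S' ψ) (fulfilled-mono S⊆S' ψ)

step-⊆ : ∀ {S S'} → Step S S' → S ⊆ S'
step-⊆ (∧-rule _ _) = there ∘ there
step-⊆ (∨-rule _ _ _ _) = there
step-⊆ (≥-rule χs _ _ _ _ _ _) = there ∘ there ∘ ∈-++⁺ʳ (map _ χs)

steps-⊆ : ∀ {S S'} → Steps S S' → S ⊆ S'
steps-⊆ ε = id
steps-⊆ (s ◅ ss) = steps-⊆ ss ∘ step-⊆ s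

expanded⇒complete : ∀ {S} → (∀ {z ψ} → (z ⊨ ψ) ∈ S → Expanded S z ψ) → Complete S
expanded⇒complete expanded _ (∧-rule ψ∈ ¬ab) = ¬ab (proj₁ (expanded ψ∈))
expanded⇒complete expanded _ (∨-rule ψ∈ a∉ b∉ _) = Sum.[ a∉ , b∉ ] (proj₁ (expanded ψ∈))
expanded⇒complete expanded _ (≥-rule _ ψ∈ count< _ _ _ _) =
  ℕₚ.<⇒≱ count< (proj₂ (expanded ψ∈))

LocallySaturated : CS → Var → Set
LocallySaturated S x = ∀ {ψ} → (x ⊨ ψ) ∈ S → Unfolded S x ψ

saturated⇒¬∧-applicable : ∀ {S x} → LocallySaturated S x → ¬ AndApplicable S x
saturated⇒¬∧-applicable saturated (_ , _ , ψ∈ , ¬ab) = ¬ab (saturated ψ∈)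

saturated⇒¬∨-applicable : ∀ {S x} → LocallySaturated S x → ¬ OrApplicable S x
saturated⇒¬∨-applicable saturated (_ , _ , ψ∈ , a∉ , b∉) = Sum.[ a∉ , b∉ ] (saturated ψ∈)

-- Saturating a variable with the ∧- and ∨-rules

UnfoldedAt : CS → Var → ℕ → Constraint → Set
UnfoldedAt T x D c = ∃[ ψ ] c ≡ (x ⊨ ψ) × Unfolded T x ψ × depth ψ < D

record Saturation (x : Var) (D : ℕ) (S : CS) : Set where
  field
    result : CS
    steps  : Steps S result
    new    : ∀ {c} → c ∈ result → c ∈ S ⊎ UnfoldedAt result x D c

open Saturation

saturation-refl : ∀ {x D S} → Saturation x D S
saturation-refl {S = S} = record { result = S ; steps = ε ; new = inj₁ }

_⨾_ : ∀ {x D S} (s : Saturation x D S) → Saturation x D (result s) → Saturation x D S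
_⨾_ {x} {D} {S} s s' =
  record { result = result s' ; steps = steps s ◅◅ steps s' ; new = Sum.[ earlier , inj₂ ] ∘ new s' }
  where
  earlier : ∀ {c} → c ∈ result s → c ∈ S ⊎ UnfoldedAt (result s') x D c
  earlier = Sum.map₂ (λ (ψ , c≡ , u , d) → ψ , c≡ , unfolded-mono (steps-⊆ (steps s')) ψ u , d)
          ∘ new s

after-step : ∀ {x D S} Ls → Step S (map (x ⊨_) Ls ++ S) → All (λ ψ → depth ψ < D) Ls →
  (s : Saturation x D (map (x ⊨_) Ls ++ S)) → All (Unfolded (result s) x) Ls → Saturation x D S
after-step {x} {D} {S} Ls step depths s unfolded =
  record { result = result s ; steps = step ◅ steps s ; new = Sum.[ added , inj₂ ] ∘ new s }
  where
  added : ∀ {c} → c ∈ map (x ⊨_) Ls ++ S → c ∈ S ⊎ UnfoldedAt (result s) x D c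
  added c∈ with ∈-++⁻ (map (x ⊨_) Ls) c∈
  ... | inj₂ c∈S = inj₁ c∈S
  ... | inj₁ c∈Ls with ∈-map⁻ (x ⊨_) c∈Ls
  ...   | ψ , ψ∈ , refl = inj₂ (ψ , refl , All.lookup unfolded ψ∈ , All.lookup depths ψ∈)

∨-unfolded : ∀ {T x a b χ} → χ ≡ a ⊎ χ ≡ b → (x ⊨ χ) ∈ T → Unfolded T x (a ∨ b)
∨-unfolded (inj₁ refl) = inj₁
∨-unfolded (inj₂ refl) = inj₂

SaturationOf : Var → ℕ → CS → Formula → Set
SaturationOf x D S ψ = Σ (Saturation x D S) λ s → Unfolded (result s) x ψ

mutual
  saturate : ∀ x D ψ S → (x ⊨ ψ) ∈ S → depth ψ < D → ND (SaturationOf x D S ψ)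
  saturate x D (a ∧ b) S ψ∈ d with ((x ⊨ a) ∈? S) ×-dec ((x ⊨ b) ∈? S)
  ... | yes ab = return (saturation-refl , ab)
  ... | no ¬ab = do
    (s₁ , ua) ← saturate x D a _ (here refl) da
    (s₂ , ub) ← saturate x D b (result s₁) (steps-⊆ (steps s₁) (there (here refl))) db
    let s = after-step (a ∷ b ∷ []) (∧-rule ψ∈ ¬ab) (da ∷ db ∷ []) (s₁ ⨾ s₂)
                       (unfolded-mono (steps-⊆ (steps s₂)) a ua ∷ ub ∷ [])
    let a∧b⊆ = steps-⊆ (steps (s₁ ⨾ s₂))
    return (s , a∧b⊆ (here refl) , a∧b⊆ (there (here refl)))
    where
    da = depth-⊔ˡ a b d
    db = depth-⊔ʳ a b d
  saturate x D (a ∨ b) S ψ∈ d with (x ⊨ a) ∈? S | (x ⊨ b) ∈? S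
  ... | yes a∈ | _ = return (saturation-refl , inj₁ a∈)
  ... | no _ | yes b∈ = return (saturation-refl , inj₂ b∈)
  ... | no a∉ | no b∉ = saturate-choice x D a S ψ∈ a∉ b∉ (inj₁ refl) (depth-⊔ˡ a b d)
                      ⊕ saturate-choice x D b S ψ∈ a∉ b∉ (inj₂ refl) (depth-⊔ʳ a b d)
  saturate x D (var _) S _ _ = return (saturation-refl , _)
  saturate x D (neg _) S _ _ = return (saturation-refl , _)
  saturate x D (⟨ _ ⟩≥ _ ∙ _) S _ _ = return (saturation-refl , _)
  saturate x D (⟨ _ ⟩≤ _ ∙ _) S _ _ = return (saturation-refl , _)

  saturate-choice : ∀ x D {a b} χ S → (x ⊨ a ∨ b) ∈ S → (x ⊨ a) ∉ S → (x ⊨ b) ∉ S →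
    χ ≡ a ⊎ χ ≡ b → depth χ < D → ND (SaturationOf x D S (a ∨ b))
  saturate-choice x D χ S ψ∈ a∉ b∉ χ≡ d = do
    (s , uχ) ← saturate x D χ ((x ⊨ χ) ∷ S) (here refl) d
    return (after-step (χ ∷ []) (∨-rule ψ∈ a∉ b∉ χ≡) (d ∷ []) s (uχ ∷ []) ,
            ∨-unfolded χ≡ (steps-⊆ (steps s) (here refl)))

saturate-all : ∀ x D Ls S → All (λ ψ → (x ⊨ ψ) ∈ S) Ls → All (λ ψ → depth ψ < D) Ls →
  ND (Σ (Saturation x D S) λ s → All (Unfolded (result s) x) Ls)
saturate-all x D [] S _ _ = return (saturation-refl , [])
saturate-all x D (ψ ∷ Ls) S (ψ∈ ∷ Ls∈) (d ∷ ds) = do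
  (s₁ , u) ← saturate x D ψ S ψ∈ d
  (s₂ , us) ← saturate-all x D Ls (result s₁) (All.map (steps-⊆ (steps s₁)) Ls∈) ds
  return (s₁ ⨾ s₂ , unfolded-mono (steps-⊆ (steps s₂)) ψ u ∷ us)

-- Expanding a variable

VarsBelow : CS → ℕ → Set
VarsBelow S b = ∀ {c} → c ∈ S → ∀ {v} → v ∈ varsC c → v < b

fresh-≥ : ∀ {S b y} → VarsBelow S b → b ≤ y → Fresh y S
fresh-≥ {S} vars<b b≤y y∈ with find (∈-concatMap⁻ varsC {xs = S} y∈)
... | c , c∈ , y∈c = ℕₚ.<⇒≱ (vars<b c∈ y∈c) b≤y

-- What expanding x may add when the variables from b on are fresh.
Subtree : Var → ℕ → Constraint → Set
Subtree x b (z ⊨ _) = b ≤ z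
Subtree x b (rel _ z y) = (z ≡ x ⊎ b ≤ z) × b ≤ y

NodeOrSubtree : Var → ℕ → Constraint → Set
NodeOrSubtree x b c = (∃[ ψ ] c ≡ (x ⊨ ψ)) ⊎ Subtree x b c

subtree-anti : ∀ {x b b'} → b ≤ b' → ∀ {c} → Subtree x b' c → Subtree x b c
subtree-anti b≤b' {_ ⊨ _} b'≤z = ℕₚ.≤-trans b≤b' b'≤z
subtree-anti b≤b' {rel _ _ _} (z , b'≤y) =
  Sum.map₂ (ℕₚ.≤-trans b≤b') z , ℕₚ.≤-trans b≤b' b'≤y

successor-subtree : ∀ {x y c} → NodeOrSubtree y (suc y) c → Subtree x y c
successor-subtree (inj₁ (_ , refl)) = ℕₚ.≤-refl
successor-subtree {c = _ ⊨ _} (inj₂ y<z) = ℕₚ.<⇒≤ y<z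
successor-subtree {c = rel _ _ _} (inj₂ (z , y<y')) =
  inj₂ (Sum.[ ℕₚ.≤-reflexive ∘ sym , ℕₚ.<⇒≤ ] z) , ℕₚ.<⇒≤ y<y'

record Expansion (New : Constraint → Set) (S : CS) (b : ℕ) : Set where
  field
    result   : CS
    bound    : ℕ
    steps    : Steps S result
    vars<    : VarsBelow result bound
    b≤bound  : b ≤ bound
    new      : ∀ {c} → c ∈ result → c ∈ S ⊎ New c
    expanded : ∀ {z ψ} → (z ⊨ ψ) ∈ result → (z ⊨ ψ) ∈ S ⊎ Expanded result z ψ

open Expansion

expansion-refl : ∀ {New S b} → VarsBelow S b → Expansion New S b
expansion-refl {S = S} {b} vars<b = record
  { result = S ; bound = b ; steps = ε ; vars< = vars<b ; b≤bound = ℕₚ.≤-refl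
  ; new = inj₁ ; expanded = inj₁ }

expansion-trans : ∀ {New New' S b} (e : Expansion New S b) → Expansion New' (result e) (bound e) →
  (∀ {c} → New' c → New c) → Expansion New S b
expansion-trans {S = S} e e' New'⇒New = record
  { result = result e' ; bound = bound e' ; steps = steps e ◅◅ steps e' ; vars< = vars< e'
  ; b≤bound = ℕₚ.≤-trans (b≤bound e) (b≤bound e')
  ; new = Sum.[ new e , inj₂ ∘ New'⇒New ] ∘ new e'
  ; expanded = Sum.[ earlier , inj₂ ] ∘ expanded e' }
  where
  earlier : ∀ {z ψ} → (z ⊨ ψ) ∈ result e → (z ⊨ ψ) ∈ S ⊎ Expanded (result e') z ψ
  earlier = Sum.map₂ (expanded-mono (steps-⊆ (steps e')) _) ∘ expanded e

ExpansionWith : Var → CS → ℕ → (CS → Set) → Set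
ExpansionWith x S b P = Σ (Expansion (Subtree x b) S b) λ e → P (result e)

NodeExpansion : Var → CS → ℕ → Set
NodeExpansion x S b =
  Σ (Expansion (NodeOrSubtree x b) S b) λ e → ∀ {ψ} → (x ⊨ ψ) ∈ S → Expanded (result e) x ψ

record Ready (x : Var) (d : ℕ) (S : CS) (b : ℕ) : Set where
  field
    saturated : LocallySaturated S x
    shallow   : ∀ {ψ} → (x ⊨ ψ) ∈ S → depth ψ ≤ d
    vars<     : VarsBelow S b
    x<b       : x < b

open Ready

ready-pres : ∀ {x d S b} → Ready x d S b → (e : Expansion (Subtree x b) S b) →
  Ready x d (result e) (bound e)
ready-pres {x} {S = S} ready e = record
  { saturated = unfolded-mono (steps-⊆ (steps e)) _ ∘ saturated ready ∘ unchanged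
  ; shallow = shallow ready ∘ unchanged
  ; vars< = vars< e
  ; x<b = ℕₚ.<-≤-trans (x<b ready) (b≤bound e) }
  where
  unchanged : ∀ {ψ} → (x ⊨ ψ) ∈ result e → (x ⊨ ψ) ∈ S
  unchanged = Sum.[ id , (λ b≤x → ⊥-elim (ℕₚ.<⇒≱ (x<b ready) b≤x)) ] ∘ new e

Leaf : CS → Var → Set
Leaf S x = ∀ {r z} → rel r x z ∉ S

leaf-∷ : ∀ {S x z ψ} → Leaf S x → Leaf ((z ⊨ ψ) ∷ S) x
leaf-∷ leaf (there Rxz) = leaf Rxz

record FreshNode (d : ℕ) (x : Var) (Lx : List Formula) (S : CS) (b : ℕ) : Set where
  field
    listed  : ∀ {ψ} → (x ⊨ ψ) ∈ S → ψ ∈ Lx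
    present : All (λ ψ → (x ⊨ ψ) ∈ S) Lx
    shallow : All (λ ψ → depth ψ < d) Lx
    x<b     : x < b
    leaf    : Leaf S x
    vars<   : VarsBelow S b

open FreshNode

saturated-ready : ∀ {d x Lx S b} → FreshNode (suc d) x Lx S b → (s : Saturation x (suc d) S) →
  All (Unfolded (result s) x) Lx → Ready x d (result s) b
saturated-ready {d} {x} {b = b} fresh s unfolded = record
  { saturated = proj₁ ∘ origin
  ; shallow = ℕ.s≤s⁻¹ ∘ proj₂ ∘ origin
  ; vars< = vars<′
  ; x<b = x<b fresh }
  where
  origin : ∀ {ψ} → (x ⊨ ψ) ∈ result s → Unfolded (result s) x ψ × depth ψ < suc d
  origin x⊨ψ∈ with new s x⊨ψ∈
  ... | inj₁ x⊨ψ∈S = let ψ∈Lx = listed fresh x⊨ψ∈S in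
    All.lookup unfolded ψ∈Lx , All.lookup (shallow fresh) ψ∈Lx
  ... | inj₂ (_ , refl , u , d) = u , d
  vars<′ : ∀ {c} → c ∈ result s → ∀ {v} → v ∈ varsC c → v < b
  vars<′ c∈ v∈ with new s c∈
  ... | inj₁ c∈S = vars< fresh c∈S v∈
  vars<′ c∈ (here refl) | inj₂ (_ , refl , _) = x<b fresh

node-expansion : ∀ {d x Lx S b} → FreshNode (suc d) x Lx S b →
  (s : Saturation x (suc d) S) → All (Unfolded (result s) x) Lx →
  (e : Expansion (Subtree x b) (result s) b) →
  (∀ {ψ} → (x ⊨ ψ) ∈ result s → Fulfilled (result e) x ψ) →
  NodeExpansion x S b
node-expansion {x = x} {S = S} {b} fresh s unfolded e fulfilled =
  record { result = result e ; bound = bound e ; steps = steps s ◅◅ steps e ; vars< = vars< e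
         ; b≤bound = b≤bound e ; new = new′ ; expanded = expanded′ } ,
  x-expanded ∘ steps-⊆ (steps s)
  where
  x-expanded : ∀ {ψ} → (x ⊨ ψ) ∈ result s → Expanded (result e) x ψ
  x-expanded {ψ} x⊨ψ∈ =
    unfolded-mono (steps-⊆ (steps e)) ψ (saturated (saturated-ready fresh s unfolded) x⊨ψ∈) ,
    fulfilled x⊨ψ∈
  new′ : ∀ {c} → c ∈ result e → c ∈ S ⊎ NodeOrSubtree x b c
  new′ c∈ with new e c∈
  ... | inj₂ c-subtree = inj₂ (inj₂ c-subtree)
  ... | inj₁ c∈s with new s c∈s
  ...   | inj₁ c∈S = inj₁ c∈S
  ...   | inj₂ (ψ , refl , _) = inj₂ (inj₁ (ψ , refl))
  expanded′ : ∀ {z ψ} → (z ⊨ ψ) ∈ result e → (z ⊨ ψ) ∈ S ⊎ Expanded (result e) z ψ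
  expanded′ c∈ with expanded e c∈
  ... | inj₂ exp = inj₂ exp
  ... | inj₁ c∈s with new s c∈s
  ...   | inj₁ c∈S = inj₁ c∈S
  ...   | inj₂ (_ , refl , _) = inj₂ (x-expanded c∈s)

Choice : Formula → Formula → Set
Choice ψ χ = χ ≡ ψ ⊎ χ ≡ ∼ ψ

choices : (L : List Formula) → ND (Σ (List Formula) (Pointwise Choice L))
choices [] = return ([] , [])
choices (ψ ∷ L) = choose ψ (inj₁ refl) ⊕ choose (∼ ψ) (inj₂ refl)
  where
  choose : ∀ χ → Choice ψ χ → ND (Σ (List Formula) (Pointwise Choice (ψ ∷ L)))
  choose χ c = do
    (χs , cs) ← choices L
    return (χ ∷ χs , c ∷ cs)

depth-choice : ∀ {ψ χ d} → Choice ψ χ → depth ψ < d → depth χ < d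
depth-choice (inj₁ refl) = id
depth-choice {ψ} (inj₂ refl) = ℕₚ.≤-<-trans (depth-∼ ψ)

pointwise-preimage : ∀ {R : A → B → Set} {xs ys} → Pointwise R xs ys →
  ∀ {y} → y ∈ ys → ∃[ x ] x ∈ xs × R x y
pointwise-preimage (r ∷ _) (here refl) = _ , here refl , r
pointwise-preimage (_ ∷ rs) (there y∈) = Product.map₂ (Product.map₁ there) (pointwise-preimage rs y∈)

pointwise-image : ∀ {R : A → B → Set} {xs ys} → Pointwise R xs ys →
  ∀ {x} → x ∈ xs → ∃[ y ] y ∈ ys × R x y
pointwise-image (r ∷ _) (here refl) = _ , here refl , r
pointwise-image (_ ∷ rs) (there x∈) = Product.map₂ (Product.map₁ there) (pointwise-image rs x∈)

with-successor : RelName → Var → Var → Formula → List Formula → CS → CS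
with-successor r x y a χs S = rel r x y ∷ (y ⊨ a) ∷ (map (y ⊨_) χs ++ S)

data SuccessorView (r : RelName) (x y : Var) (a : Formula) (χs : List Formula) (S : CS) :
                   Constraint → Set where
  edge   : SuccessorView r x y a χs S (rel r x y)
  target : SuccessorView r x y a χs S (y ⊨ a)
  choice : ∀ {χ} → χ ∈ χs → SuccessorView r x y a χs S (y ⊨ χ)
  old    : ∀ {c} → c ∈ S → SuccessorView r x y a χs S c

successor-view : ∀ {r x y a χs S c} → c ∈ with-successor r x y a χs S → SuccessorView r x y a χs S c
successor-view (here refl) = edge
successor-view (there (here refl)) = target
successor-view {y = y} {χs = χs} (there (there c∈)) with ∈-++⁻ (map (y ⊨_) χs) c∈
... | inj₂ c∈S = old c∈S
... | inj₁ c∈χs with ∈-map⁻ (y ⊨_) c∈χs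
...   | _ , χ∈ , refl = choice χ∈

successor-choice : ∀ {r x y a χs S χ} → χ ∈ χs → (y ⊨ χ) ∈ with-successor r x y a χs S
successor-choice {y = y} χ∈ = there (there (∈-++⁺ˡ (∈-map⁺ (y ⊨_) χ∈)))

successor-old : ∀ {r x y a χs S c} → c ∈ S → c ∈ with-successor r x y a χs S
successor-old {y = y} {χs = χs} c∈ = there (there (∈-++⁺ʳ (map (y ⊨_) χs) c∈))

successor-fresh : ∀ {d x S b r n a χs} → Ready x d S b → (x ⊨ ⟨ r ⟩≥ n ∙ a) ∈ S →
  Pointwise Choice (modalFs S r x) χs → FreshNode d b (a ∷ χs) (with-successor r x b a χs S) (suc b)
successor-fresh {d} {x} {S} {b} {r} {a = a} {χs} ready ψ∈ cs = record
  { listed = listed′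
  ; present = there (here refl) ∷ All.tabulate successor-choice
  ; shallow = shallow ready ψ∈ ∷ All.tabulate shallow-choice
  ; x<b = ℕₚ.≤-refl
  ; leaf = leaf′
  ; vars< = vars<′ }
  where
  old≢b : ∀ {c} → c ∈ S → ∀ {v} → v ∈ varsC c → v ≢ b
  old≢b c∈ v∈ refl = ℕₚ.<-irrefl refl (vars< ready c∈ v∈)
  listed′ : ∀ {ψ} → (b ⊨ ψ) ∈ with-successor r x b a χs S → ψ ∈ a ∷ χs
  listed′ c∈ with successor-view c∈
  ... | target = here refl
  ... | choice χ∈ = there χ∈
  ... | old c∈S = ⊥-elim (old≢b c∈S (here refl) refl)
  shallow-choice : ∀ {χ} → χ ∈ χs → depth χ < d
  shallow-choice χ∈ with pointwise-preimage cs χ∈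
  ... | ψ , ψ∈ , c with ∈-modalFs⁻ S ψ∈
  ...   | _ , inj₁ graded∈ = depth-choice c (shallow ready graded∈)
  ...   | _ , inj₂ graded∈ = depth-choice c (shallow ready graded∈)
  leaf′ : Leaf (with-successor r x b a χs S) b
  leaf′ c∈ with successor-view c∈
  ... | edge = ℕₚ.<-irrefl refl (x<b ready)
  ... | old c∈S = old≢b c∈S (here refl) refl
  vars<′ : ∀ {c} → c ∈ with-successor r x b a χs S → ∀ {v} → v ∈ varsC c → v < suc b
  vars<′ c∈ v∈ with successor-view c∈
  vars<′ _ (here refl) | edge = ℕₚ.m<n⇒m<1+n (x<b ready)
  vars<′ _ (there (here refl)) | edge = ℕₚ.≤-refl
  vars<′ _ (here refl) | target = ℕₚ.≤-refl
  vars<′ _ (here refl) | choice _ = ℕₚ.≤-refl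
  ... | old c∈S = ℕₚ.m<n⇒m<1+n (vars< ready c∈S v∈)

count-successor : ∀ {S b r x a χs} → VarsBelow S b →
  count S r x a < count (with-successor r x b a χs S) r x a
count-successor {S} {b} {r} {x} {a} {χs} vars<b = unique-⊆⇒length≤ unique ⊆counted
  where
  S' = with-successor r x b a χs S
  b∉ : ∀ {y} → y ∈ counted S r x a → b ≢ y
  b∉ y∈ b≡y = ℕₚ.<-irrefl (sym b≡y) (vars<b (proj₁ (∈-counted⁻ S y∈)) (there (here refl)))
  unique : Unique (b ∷ counted S r x a)
  unique = All.tabulate b∉ ∷ counted-unique S r x a
  ⊆counted : b ∷ counted S r x a ⊆ counted S' r x a
  ⊆counted (here refl) = ∈-counted⁺ S' (here refl) (there (here refl))
  ⊆counted (there y∈) = let Rxy , y⊨a = ∈-counted⁻ S y∈ in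
    ∈-counted⁺ S' (successor-old {χs = χs} Rxy) (successor-old {χs = χs} y⊨a)

successor-expansion : ∀ {d x S b r n a} → Ready x d S b → (x ⊨ ⟨ r ⟩≥ n ∙ a) ∈ S →
  count S r x a < n → ((χs , _) : Σ (List Formula) (Pointwise Choice (modalFs S r x))) →
  NodeExpansion b (with-successor r x b a χs S) (suc b) →
  ExpansionWith x S b λ S' → count S r x a < count S' r x a
successor-expansion {x = x} {S} {b} {r} {a = a} ready ψ∈ count< (χs , cs) (e , b-expanded) =
  record { result = result e ; bound = bound e ; steps = step ◅ steps e ; vars< = vars< e
         ; b≤bound = ℕₚ.<⇒≤ (b≤bound e) ; new = new′ ; expanded = expanded′ } ,
  ℕₚ.<-≤-trans (count-successor {χs = χs} (vars< ready)) (count-mono (steps-⊆ (steps e)) r x a)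
  where
  step : Step S (with-successor r x b a χs S)
  step = ≥-rule χs ψ∈ count< (saturated⇒¬∧-applicable (saturated ready))
                (saturated⇒¬∨-applicable (saturated ready)) (fresh-≥ (vars< ready) ℕₚ.≤-refl) cs
  new′ : ∀ {c} → c ∈ result e → c ∈ S ⊎ Subtree x b c
  new′ c∈ with new e c∈
  ... | inj₂ c-below = inj₂ (successor-subtree c-below)
  ... | inj₁ c∈S' with successor-view c∈S'
  ...   | edge = inj₂ (inj₁ refl , ℕₚ.≤-refl)
  ...   | target = inj₂ ℕₚ.≤-refl
  ...   | choice _ = inj₂ ℕₚ.≤-refl
  ...   | old c∈S = inj₁ c∈S
  expanded′ : ∀ {z ψ} → (z ⊨ ψ) ∈ result e → (z ⊨ ψ) ∈ S ⊎ Expanded (result e) z ψ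
  expanded′ c∈ with expanded e c∈
  ... | inj₂ exp = inj₂ exp
  ... | inj₁ c∈S' with successor-view c∈S'
  ...   | target = inj₂ (b-expanded (there (here refl)))
  ...   | choice χ∈ = inj₂ (b-expanded (successor-choice χ∈))
  ...   | old c∈S = inj₁ c∈S

out-of-fuel : ∀ {n c} → n ≤ c + 0 → ¬ c < n
out-of-fuel {c = c} fuel = ℕₚ.≤⇒≯ (ℕₚ.≤-trans fuel (ℕₚ.≤-reflexive (ℕₚ.+-identityʳ c)))

fuel-step : ∀ {n c c' k} → n ≤ c + suc k → c < c' → n ≤ c' + k
fuel-step {c = c} {k = k} fuel c<c' = begin
  _            ≤⟨ fuel ⟩
  c + suc k    ≡⟨ ℕₚ.+-suc c k ⟩
  suc c + k    ≤⟨ ℕₚ.+-monoˡ-≤ k c<c' ⟩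
  _            ∎
  where open ℕₚ.≤-Reasoning

mutual
  node : ∀ d x Lx S b → FreshNode d x Lx S b → ND (NodeExpansion x S b)
  node zero x [] S b fresh =
    return (expansion-refl (vars< fresh) , λ x⊨ψ∈ → case listed fresh x⊨ψ∈ of λ ())
  node zero x (_ ∷ _) S b fresh = ⊥-elim (ℕₚ.n≮0 (All.head (shallow fresh)))
  node (suc d) x Lx S b fresh = do
    (s , unfolded) ← saturate-all x (suc d) Lx S (present fresh) (shallow fresh)
    (e , fulfilled) ← fulfil-all d x (result s) (result s) b (saturated-ready fresh s unfolded) id
    return (node-expansion fresh s unfolded e fulfilled)

  fulfil-all : ∀ d x T S b → Ready x d S b → T ⊆ S →
    ND (ExpansionWith x S b λ S' → ∀ {ψ} → (x ⊨ ψ) ∈ T → Fulfilled S' x ψ)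
  fulfil-all d x [] S b ready _ = return (expansion-refl (vars< ready) , λ ())
  fulfil-all d x (c ∷ T) S b ready T⊆S = do
    (e₁ , f₁) ← fulfil-one d x c S b ready (T⊆S (here refl))
    (e₂ , f₂) ← fulfil-all d x T (result e₁) (bound e₁) (ready-pres ready e₁)
                           (steps-⊆ (steps e₁) ∘ T⊆S ∘ there)
    return (expansion-trans e₁ e₂ (subtree-anti (b≤bound e₁)) ,
            λ { {ψ} (here refl) → fulfilled-mono (steps-⊆ (steps e₂)) ψ (f₁ refl)
              ; (there x⊨ψ∈) → f₂ x⊨ψ∈ })

  fulfil-one : ∀ d x c S b → Ready x d S b → c ∈ S →
    ND (ExpansionWith x S b λ S' → ∀ {ψ} → c ≡ (x ⊨ ψ) → Fulfilled S' x ψ)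
  fulfil-one d x (z ⊨ ψ) S b ready ψ∈ with z ℕ.≟ x
  ... | no z≢x = return (expansion-refl (vars< ready) , λ { refl → ⊥-elim (z≢x refl) })
  ... | yes refl = do
    (e , f) ← fulfil d x ψ S b ready ψ∈
    return (e , λ { refl → f })
  fulfil-one d x (rel _ _ _) S b ready _ = return (expansion-refl (vars< ready) , λ ())

  fulfil : ∀ d x ψ S b → Ready x d S b → (x ⊨ ψ) ∈ S →
    ND (ExpansionWith x S b λ S' → Fulfilled S' x ψ)
  fulfil d x (⟨ r ⟩≥ n ∙ a) S b ready ψ∈ = fulfil-≥ d x r n a n S b ready ψ∈ (ℕₚ.m≤n+m n _)
  fulfil d x (var _) S b ready _ = return (expansion-refl (vars< ready) , _)
  fulfil d x (neg _) S b ready _ = return (expansion-refl (vars< ready) , _)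
  fulfil d x (_ ∧ _) S b ready _ = return (expansion-refl (vars< ready) , _)
  fulfil d x (_ ∨ _) S b ready _ = return (expansion-refl (vars< ready) , _)
  fulfil d x (⟨ _ ⟩≤ _ ∙ _) S b ready _ = return (expansion-refl (vars< ready) , _)

  -- Every added successor raises the count, so n rounds of fuel suffice.
  fulfil-≥ : ∀ d x r n a k S b → Ready x d S b → (x ⊨ ⟨ r ⟩≥ n ∙ a) ∈ S →
    n ≤ count S r x a + k →
    ND (ExpansionWith x S b λ S' → n ≤ count S' r x a)
  fulfil-≥ d x r n a k S b ready ψ∈ fuel with count S r x a ℕ.<? n
  ... | no count≮ = return (expansion-refl (vars< ready) , ℕₚ.≮⇒≥ count≮)
  fulfil-≥ d x r n a zero S b ready ψ∈ fuel | yes count< = ⊥-elim (out-of-fuel fuel count<)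
  fulfil-≥ d x r n a (suc k) S b ready ψ∈ fuel | yes count< = do
    (e₁ , count↑) ← add-successor d x r n a S b ready ψ∈ count<
    (e₂ , f) ← fulfil-≥ d x r n a k (result e₁) (bound e₁) (ready-pres ready e₁)
                        (steps-⊆ (steps e₁) ψ∈) (fuel-step fuel count↑)
    return (expansion-trans e₁ e₂ (subtree-anti (b≤bound e₁)) , f)

  add-successor : ∀ d x r n a S b → Ready x d S b → (x ⊨ ⟨ r ⟩≥ n ∙ a) ∈ S →
    count S r x a < n →
    ND (ExpansionWith x S b λ S' → count S r x a < count S' r x a)
  add-successor d x r n a S b ready ψ∈ count< = do
    (χs , cs) ← choices (modalFs S r x)
    e ← node d b (a ∷ χs) (with-successor r x b a χs S) (suc b) (successor-fresh ready ψ∈ cs)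
    return (successor-expansion ready ψ∈ count< (χs , cs) e)

initial-fresh : ∀ φ → FreshNode (suc (depth φ)) 0 (φ ∷ []) (initial φ) 1
initial-fresh φ = record
  { listed = λ { (here refl) → here refl }
  ; present = here refl ∷ []
  ; shallow = ℕₚ.≤-refl ∷ []
  ; x<b = s≤s z≤n
  ; leaf = λ { (here ()) }
  ; vars< = λ { (here refl) (here refl) → s≤s z≤n } }

Run : Formula → Set
Run φ = Σ CS λ S → Steps (initial φ) S × Complete S

run : ∀ φ → ND (Run φ)
run φ = do
  (e , φ-expanded) ← node (suc (depth φ)) 0 (φ ∷ []) (initial φ) 1 (initial-fresh φ)
  let all-expanded : ∀ {z ψ} → (z ⊨ ψ) ∈ result e → Expanded (result e) z ψ
      all-expanded = Sum.[ (λ { (here refl) → φ-expanded (here refl) }) , id ] ∘ expanded e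
  return (result e , steps e , expanded⇒complete all-expanded)

saturation-leaf : ∀ {x D S} → Leaf S x → (s : Saturation x D S) → Leaf (result s) x
saturation-leaf leaf s Rxz with new s Rxz
... | inj₁ Rxz∈S = leaf Rxz∈S
... | inj₂ (_ , () , _)

graded-old : ∀ {r x b a χs S r' z ψ} → z < b →
  GradedAt (with-successor r x b a χs S) r' z ψ → GradedAt S r' z ψ
graded-old z<b (n , inj₁ graded) with successor-view graded
... | old graded∈S = n , inj₁ graded∈S
... | target = ⊥-elim (ℕₚ.<-irrefl refl z<b)
... | choice _ = ⊥-elim (ℕₚ.<-irrefl refl z<b)
graded-old z<b (n , inj₂ graded) with successor-view graded
... | old graded∈S = n , inj₂ graded∈S
... | target = ⊥-elim (ℕₚ.<-irrefl refl z<b)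
... | choice _ = ⊥-elim (ℕₚ.<-irrefl refl z<b)

assign : (Var → A) → Var → A → Var → A
assign m b w v with v ℕ.≟ b
... | yes _ = w
... | no _ = m v

assign-new : ∀ (m : Var → A) b w → assign m b w b ≡ w
assign-new m b w with b ℕ.≟ b
... | yes _ = refl
... | no b≢b = ⊥-elim (b≢b refl)

assign-old : ∀ (m : Var → A) {b} w {v} → v < b → assign m b w v ≡ m v
assign-old m {b} w {v} v<b with v ℕ.≟ b
... | yes refl = ⊥-elim (ℕₚ.<-irrefl refl v<b)
... | no _ = refl

-- Following a model

module Realisation (M : Model) where

  ∼-sound : ∀ {w} ψ → M , w ⊩ (∼ ψ) → ¬ M , w ⊩ ψ
  ∼-sound (var p) ¬v v = ¬v v
  ∼-sound (neg p) v ¬v = ¬v v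
  ∼-sound (a ∧ b) (inj₁ h) (ha , _) = ∼-sound a h ha
  ∼-sound (a ∧ b) (inj₂ h) (_ , hb) = ∼-sound b h hb
  ∼-sound (a ∨ b) (h , _) (inj₁ ha) = ∼-sound a h ha
  ∼-sound (a ∨ b) (_ , h) (inj₂ hb) = ∼-sound b h hb
  ∼-sound (⟨ r ⟩≥ zero ∙ a) (v , ¬v) _ = ¬v v
  ∼-sound (⟨ r ⟩≥ suc n ∙ a) ¬more more = ¬more more
  ∼-sound (⟨ r ⟩≤ n ∙ a) more ¬more = ¬more more

  ∼-complete : ∀ {w} ψ → ¬ M , w ⊩ ψ → ¬ ¬ M , w ⊩ (∼ ψ)
  ∼-complete (var p) ¬v k = k ¬v
  ∼-complete (neg p) ¬¬v k = ¬¬v k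
  ∼-complete (a ∧ b) ¬ab k =
    ∼-complete a (λ ha → ∼-complete b (λ hb → ¬ab (ha , hb)) (k ∘ inj₂)) (k ∘ inj₁)
  ∼-complete (a ∨ b) ¬ab k =
    ∼-complete a (¬ab ∘ inj₁) λ h∼a → ∼-complete b (¬ab ∘ inj₂) λ h∼b → k (h∼a , h∼b)
  ∼-complete (⟨ r ⟩≥ zero ∙ a) ¬h _ = ¬h ((λ ()) , (λ { {()} }) , λ ())
  ∼-complete (⟨ r ⟩≥ suc n ∙ a) ¬h k = k ¬h
  ∼-complete (⟨ r ⟩≤ n ∙ a) ¬h k = ¬h k

  ⊩-or-⊩∼ : ∀ {w} ψ → ¬ ¬ (M , w ⊩ ψ ⊎ M , w ⊩ (∼ ψ))
  ⊩-or-⊩∼ ψ k = ¬¬-excluded-middle λ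
    { (yes h) → k (inj₁ h)
    ; (no ¬h) → ∼-complete ψ ¬h (k ∘ inj₂) }

  unused-world : ∀ {n} (f : Fin n → W M) → Injective _≡_ _≡_ f →
    (ws : List (W M)) → length ws < n → ¬ ¬ (∃[ i ] f i ∉ ws)
  unused-world f f-injective ws |ws|<n ¬unused =
    Finₚ.sequence ¬¬-applicative (λ i f∉ → ¬unused (i , f∉)) λ f∈ →
      ℕₚ.<⇒≱ |ws|<n (Finₚ.injective⇒≤ {f = index ∘ f∈} λ {i} {j} e → f-injective (begin
        f i                       ≡⟨ lookup-index (f∈ i) ⟩
        lookup ws (index (f∈ i))  ≡⟨ cong (lookup ws) e ⟩
        lookup ws (index (f∈ j))  ≡⟨ lookup-index (f∈ j) ⟨
        f j                       ∎))
    where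
    open ≡-Reasoning
    ¬¬-applicative = RawMonad.rawApplicative ¬¬-Monad

  record Realises (S : CS) (m : Var → W M) : Set where
    field
      holds      : ∀ {z ψ} → (z ⊨ ψ) ∈ S → M , m z ⊩ ψ
      accessible : ∀ {r z y} → rel r z y ∈ S → Acc M r (m z) (m y)
      separated  : ∀ {r z y y'} → rel r z y ∈ S → rel r z y' ∈ S → m y ≡ m y' → y ≡ y'
      faithful   : ∀ {r z y ψ} → rel r z y ∈ S → GradedAt S r z ψ → M , m y ⊩ ψ → (y ⊨ ψ) ∈ S

  open Realises

  Realised : CS → Set
  Realised S = Σ (Var → W M) (Realises S)

  realised⇒clash-free : ∀ {S} → Realised S → ClashFree S
  realised⇒clash-free (m , real) (inj₁ (_ , _ , v∈ , ¬v∈)) = holds real ¬v∈ (holds real v∈)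
  realised⇒clash-free {S} (m , real) (inj₂ (x , r , n , a , ψ∈ , n<count)) =
    holds real ψ∈ (m ∘ y , y-injective , λ i → accessible real (Rxy i) , holds real (y⊨a i))
    where
    y : Fin (suc n) → Var
    y i = lookup (counted S r x a) (Fin.inject≤ i n<count)
    Rxy : ∀ i → rel r x (y i) ∈ S
    Rxy i = proj₁ (∈-counted⁻ S (∈-lookup (Fin.inject≤ i n<count)))
    y⊨a : ∀ i → (y i ⊨ a) ∈ S
    y⊨a i = proj₂ (∈-counted⁻ S (∈-lookup (Fin.inject≤ i n<count)))
    y-injective : Injective _≡_ _≡_ (m ∘ y)
    y-injective e = Finₚ.inject≤-injective n<count n<count _ _
      (lookup-injective (counted-unique S r x a) (separated real (Rxy _) (Rxy _) e))

  -- Constraints on a variable without successors cannot break faithfulness.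
  realises-∷ : ∀ {S m x χ} → Realises S m → Leaf S x → M , m x ⊩ χ → Realises ((x ⊨ χ) ∷ S) m
  realises-∷ {S} {m} {x} {χ} real leaf h = record
    { holds = λ { (here refl) → h ; (there c∈) → holds real c∈ }
    ; accessible = λ { (there c∈) → accessible real c∈ }
    ; separated = λ { (there c∈) (there c'∈) → separated real c∈ c'∈ }
    ; faithful = faithful′ }
    where
    faithful′ : ∀ {r z y ψ} → rel r z y ∈ (x ⊨ χ) ∷ S → GradedAt ((x ⊨ χ) ∷ S) r z ψ →
      M , m y ⊩ ψ → (y ⊨ ψ) ∈ (x ⊨ χ) ∷ S
    faithful′ (there Rzy) (_ , inj₁ (here refl)) _ = ⊥-elim (leaf Rzy)
    faithful′ (there Rzy) (_ , inj₂ (here refl)) _ = ⊥-elim (leaf Rzy)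
    faithful′ (there Rzy) (n , inj₁ (there graded)) h = there (faithful real Rzy (n , inj₁ graded) h)
    faithful′ (there Rzy) (n , inj₂ (there graded)) h = there (faithful real Rzy (n , inj₂ graded) h)

  realises-successor : ∀ {S m b r x n a χs w} → Realises S m → VarsBelow S b →
    (x ⊨ ⟨ r ⟩≥ n ∙ a) ∈ S → Acc M r (m x) w → M , w ⊩ a →
    (∀ {y} → rel r x y ∈ S → m y ≢ w) →
    Pointwise Choice (modalFs S r x) χs → All (M , w ⊩_) χs →
    Realises (with-successor r x b a χs S) (assign m b w)
  realises-successor {S} {m} {b} {r} {x} {a = a} {χs} {w} real vars<b ψ∈ Rxw w⊩a w-unused cs w⊩χs =
    record { holds = holds′ ; accessible = accessible′ ; separated = separated′ ; faithful = faithful′ }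
    where
    m' = assign m b w
    S' = with-successor r x b a χs S
    new-world : m' b ≡ w
    new-world = assign-new m b w
    old-world : ∀ {c} → c ∈ S → ∀ {v} → v ∈ varsC c → m' v ≡ m v
    old-world c∈ v∈ = assign-old m w (vars<b c∈ v∈)
    holds′ : ∀ {z ψ} → (z ⊨ ψ) ∈ S' → M , m' z ⊩ ψ
    holds′ {ψ = ψ} c∈ with successor-view c∈
    ... | target = subst (M ,_⊩ a) (sym new-world) w⊩a
    ... | choice χ∈ = subst (M ,_⊩ ψ) (sym new-world) (All.lookup w⊩χs χ∈)
    ... | old c∈S = subst (M ,_⊩ ψ) (sym (old-world c∈S (here refl))) (holds real c∈S)
    accessible′ : ∀ {r' z y} → rel r' z y ∈ S' → Acc M r' (m' z) (m' y)
    accessible′ c∈ with successor-view c∈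
    ... | edge = subst₂ (Acc M r) (sym (old-world ψ∈ (here refl))) (sym new-world) Rxw
    ... | old c∈S = subst₂ (Acc M _) (sym (old-world c∈S (here refl)))
                                     (sym (old-world c∈S (there (here refl)))) (accessible real c∈S)
    old-target : ∀ {r' z y} → rel r' z y ∈ S → m' y ≡ m y
    old-target Rzy = old-world Rzy (there (here refl))
    separated′ : ∀ {r' z y y'} → rel r' z y ∈ S' → rel r' z y' ∈ S' → m' y ≡ m' y' → y ≡ y'
    separated′ c∈ c'∈ e with successor-view c∈ | successor-view c'∈
    ... | edge | edge = refl
    ... | edge | old Rxy' = ⊥-elim (w-unused Rxy' (trans (sym (old-target Rxy')) (trans (sym e) new-world)))
    ... | old Rxy | edge = ⊥-elim (w-unused Rxy (trans (sym (old-target Rxy)) (trans e new-world)))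
    ... | old Rzy | old Rzy' = separated real Rzy Rzy' (trans (sym (old-target Rzy)) (trans e (old-target Rzy')))
    faithful′ : ∀ {r' z y ψ} → rel r' z y ∈ S' → GradedAt S' r' z ψ → M , m' y ⊩ ψ →
      (y ⊨ ψ) ∈ S'
    faithful′ {ψ = ψ} c∈ graded h with successor-view c∈
    ... | old Rzy = successor-old {χs = χs}
      (faithful real Rzy (graded-old (vars<b Rzy (here refl)) graded) (subst (M ,_⊩ ψ) (old-target Rzy) h))
    ... | edge with pointwise-image cs (∈-modalFs⁺ S (graded-old (vars<b ψ∈ (here refl)) graded))
    ...   | χ , χ∈ , inj₁ refl = successor-choice χ∈
    ...   | χ , χ∈ , inj₂ refl =
      ⊥-elim (∼-sound ψ (All.lookup w⊩χs χ∈) (subst (M ,_⊩ ψ) new-world h))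

  -- Some of the n distinct witnesses of ⟨r⟩≥n a is the world of no counted successor, and by
  -- faithfulness a successor whose world satisfies a is counted.
  successor-world : ∀ {S m r x n a} → Realises S m → (x ⊨ ⟨ r ⟩≥ n ∙ a) ∈ S →
    count S r x a < n →
    ¬ ¬ (∃[ w ] Acc M r (m x) w × M , w ⊩ a × (∀ {y} → rel r x y ∈ S → m y ≢ w))
  successor-world {S} {m} {r} {x} {n} {a} real ψ∈ count< k =
    unused-world f f-injective (map m (counted S r x a)) |worlds|<n λ (i , fi∉) →
      k (f i , proj₁ (f-ok i) , proj₂ (f-ok i) , λ Rxy my≡fi → fi∉ (subst (_∈ _) my≡fi
        (∈-map⁺ m (∈-counted⁺ S Rxy
          (faithful real Rxy (n , inj₁ ψ∈) (subst (M ,_⊩ a) (sym my≡fi) (proj₂ (f-ok i))))))))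
    where
    f = proj₁ (holds real ψ∈)
    f-injective = proj₁ (proj₂ (holds real ψ∈))
    f-ok = proj₂ (proj₂ (holds real ψ∈))
    |worlds|<n = subst (_< n) (sym (length-map m (counted S r x a))) count<

  choices◇ : ∀ w L → ◇ (λ p → All (M , w ⊩_) (proj₁ p)) (choices L)
  choices◇ w [] = ◇-return []
  choices◇ w (ψ ∷ L) = ◇-stable λ k → ⊩-or-⊩∼ ψ λ
    { (inj₁ h) → k (◇-left (◇-bind (choices◇ w L) (◇-return ∘ (h ∷_))))
    ; (inj₂ h) → k (◇-right (◇-bind (choices◇ w L) (◇-return ∘ (h ∷_)))) }

  ◇Realises : ∀ {x D S} {P : Saturation x D S → Set} →
    (Var → W M) → ND (Σ (Saturation x D S) P) → Set
  ◇Realises m = ◇ (λ p → Realises (result (proj₁ p)) m)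

  mutual
    saturate◇ : ∀ x D ψ S ψ∈ d {m} → Leaf S x → Realises S m →
      ◇Realises m (saturate x D ψ S ψ∈ d)
    saturate◇ x D (a ∧ b) S ψ∈ d leaf real with ((x ⊨ a) ∈? S) ×-dec ((x ⊨ b) ∈? S)
    ... | yes _ = ◇-return real
    ... | no _ =
      ◇-bind (saturate◇ x D a _ _ _ leaf₀ real₀) λ {p} real₁ →
      ◇-bind (saturate◇ x D b _ _ _ (saturation-leaf leaf₀ (proj₁ p)) real₁) ◇-return
      where
      leaf₀ = leaf-∷ (leaf-∷ leaf)
      real₀ = realises-∷ (realises-∷ real leaf (proj₂ (holds real ψ∈))) (leaf-∷ leaf)
                         (proj₁ (holds real ψ∈))
    saturate◇ x D (a ∨ b) S ψ∈ d leaf real with (x ⊨ a) ∈? S | (x ⊨ b) ∈? S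
    ... | yes _ | _ = ◇-return real
    ... | no _ | yes _ = ◇-return real
    ... | no a∉ | no b∉ with holds real ψ∈
    ...   | inj₁ ha = ◇-left (saturate-choice◇ x D a S ψ∈ a∉ b∉ (inj₁ refl) _ leaf real ha)
    ...   | inj₂ hb = ◇-right (saturate-choice◇ x D b S ψ∈ a∉ b∉ (inj₂ refl) _ leaf real hb)
    saturate◇ x D (var _) S _ _ _ real = ◇-return real
    saturate◇ x D (neg _) S _ _ _ real = ◇-return real
    saturate◇ x D (⟨ _ ⟩≥ _ ∙ _) S _ _ _ real = ◇-return real
    saturate◇ x D (⟨ _ ⟩≤ _ ∙ _) S _ _ _ real = ◇-return real

    saturate-choice◇ : ∀ x D {a b} χ S ψ∈ a∉ b∉ χ≡ d {m} → Leaf S x → Realises S m →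
      M , m x ⊩ χ →
      ◇Realises m (saturate-choice x D {a} {b} χ S ψ∈ a∉ b∉ χ≡ d)
    saturate-choice◇ x D χ S ψ∈ a∉ b∉ χ≡ d leaf real h =
      ◇-bind (saturate◇ x D χ _ _ _ (leaf-∷ leaf) (realises-∷ real leaf h)) ◇-return

  saturate-all◇ : ∀ x D Ls S Ls∈ ds {m} → Leaf S x → Realises S m →
    ◇Realises m (saturate-all x D Ls S Ls∈ ds)
  saturate-all◇ x D [] S _ _ leaf real = ◇-return real
  saturate-all◇ x D (ψ ∷ Ls) S (_ ∷ _) (_ ∷ _) leaf real =
    ◇-bind (saturate◇ x D ψ S _ _ leaf real) λ {p} real₁ →
    ◇-bind (saturate-all◇ x D Ls _ _ _ (saturation-leaf leaf (proj₁ p)) real₁) ◇-return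

  ◇Realised : ∀ {New S b} {P : Expansion New S b → Set} → ND (Σ (Expansion New S b) P) → Set
  ◇Realised = ◇ (Realised ∘ result ∘ proj₁)

  mutual
    node◇ : ∀ d x Lx S b fresh → Realised S → ◇Realised (node d x Lx S b fresh)
    node◇ zero x [] S b fresh real = ◇-return real
    node◇ zero x (_ ∷ _) S b fresh real = ⊥-elim (ℕₚ.n≮0 (All.head (shallow fresh)))
    node◇ (suc d) x Lx S b fresh (m , real) =
      ◇-bind (saturate-all◇ x (suc d) Lx S _ _ (leaf fresh) real) λ real₁ →
      ◇-bind (fulfil-all◇ d x _ _ b _ id (m , real₁)) ◇-return

    fulfil-all◇ : ∀ d x T S b ready (T⊆S : T ⊆ S) → Realised S →
      ◇Realised (fulfil-all d x T S b ready T⊆S)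
    fulfil-all◇ d x [] S b ready _ real = ◇-return real
    fulfil-all◇ d x (c ∷ T) S b ready T⊆S real =
      ◇-bind (fulfil-one◇ d x c S b ready _ real) λ real₁ →
      ◇-bind (fulfil-all◇ d x T _ _ _ _ real₁) ◇-return

    fulfil-one◇ : ∀ d x c S b ready c∈ → Realised S → ◇Realised (fulfil-one d x c S b ready c∈)
    fulfil-one◇ d x (z ⊨ ψ) S b ready ψ∈ real with z ℕ.≟ x
    ... | no _ = ◇-return real
    ... | yes refl = ◇-bind (fulfil◇ d x ψ S b ready ψ∈ real) ◇-return
    fulfil-one◇ d x (rel _ _ _) S b ready _ real = ◇-return real

    fulfil◇ : ∀ d x ψ S b ready ψ∈ → Realised S → ◇Realised (fulfil d x ψ S b ready ψ∈)
    fulfil◇ d x (⟨ r ⟩≥ n ∙ a) S b ready ψ∈ real = fulfil-≥◇ d x r n a n S b ready ψ∈ _ real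
    fulfil◇ d x (var _) S b ready _ real = ◇-return real
    fulfil◇ d x (neg _) S b ready _ real = ◇-return real
    fulfil◇ d x (_ ∧ _) S b ready _ real = ◇-return real
    fulfil◇ d x (_ ∨ _) S b ready _ real = ◇-return real
    fulfil◇ d x (⟨ _ ⟩≤ _ ∙ _) S b ready _ real = ◇-return real

    fulfil-≥◇ : ∀ d x r n a k S b ready ψ∈ fuel → Realised S →
      ◇Realised (fulfil-≥ d x r n a k S b ready ψ∈ fuel)
    fulfil-≥◇ d x r n a k S b ready ψ∈ fuel real with count S r x a ℕ.<? n
    ... | no _ = ◇-return real
    fulfil-≥◇ d x r n a zero S b ready ψ∈ fuel real | yes count< = ⊥-elim (out-of-fuel fuel count<)
    fulfil-≥◇ d x r n a (suc k) S b ready ψ∈ fuel real | yes count< =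
      ◇-bind (add-successor◇ d x r n a S b ready ψ∈ count< real) λ real₁ →
      ◇-bind (fulfil-≥◇ d x r n a k _ _ _ _ _ real₁) ◇-return

    add-successor◇ : ∀ d x r n a S b ready ψ∈ count< → Realised S →
      ◇Realised (add-successor d x r n a S b ready ψ∈ count<)
    add-successor◇ d x r n a S b ready ψ∈ count< (m , real) =
      ◇-stable λ k → successor-world real ψ∈ count< λ (w , Rxw , w⊩a , w-unused) → k
        (◇-bind (choices◇ w (modalFs S r x)) λ {(χs , cs)} w⊩χs →
         ◇-bind (node◇ d b (a ∷ χs) _ (suc b) _
                   (assign m b w , realises-successor real (vars< ready) ψ∈ Rxw w⊩a w-unused cs w⊩χs))
                ◇-return)

  run◇ : ∀ φ {w} → M , w ⊩ φ → ◇ (Realised ∘ proj₁) (run φ)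
  run◇ φ {w} w⊩φ =
    ◇-bind (node◇ (suc (depth φ)) 0 (φ ∷ []) (initial φ) 1 (initial-fresh φ) ((λ _ → w) , real))
           ◇-return
    where
    real : Realises (initial φ) (λ _ → w)
    real = record
      { holds = λ { (here refl) → w⊩φ }
      ; accessible = λ { (here ()) }
      ; separated = λ { (here ()) }
      ; faithful = λ { (here ()) } }

ClashAt : CS → Constraint → Set
ClashAt S (x ⊨ var p) = (x ⊨ neg p) ∈ S
ClashAt S (x ⊨ ⟨ r ⟩≤ n ∙ a) = n < count S r x a
ClashAt S _ = ⊥

clashAt? : ∀ S c → Dec (ClashAt S c)
clashAt? S (x ⊨ var p) = (x ⊨ neg p) ∈? S
clashAt? S (x ⊨ ⟨ r ⟩≤ n ∙ a) = n ℕ.<? count S r x a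
clashAt? S (_ ⊨ neg _) = no id
clashAt? S (_ ⊨ _ ∧ _) = no id
clashAt? S (_ ⊨ _ ∨ _) = no id
clashAt? S (_ ⊨ ⟨ _ ⟩≥ _ ∙ _) = no id
clashAt? S (rel _ _ _) = no id

clash? : ∀ S → Dec (Clash S)
clash? S = map′ (clash ∘ find) unclash (any? (clashAt? S) S)
  where
  clash : ∃[ c ] c ∈ S × ClashAt S c → Clash S
  clash ((x ⊨ var p) , c∈ , ¬p∈) = inj₁ (x , p , c∈ , ¬p∈)
  clash ((x ⊨ ⟨ r ⟩≤ n ∙ a) , c∈ , n<) = inj₂ (x , r , n , a , c∈ , n<)
  unclash : Clash S → Any (ClashAt S) S
  unclash (inj₁ (_ , _ , p∈ , ¬p∈)) = lose p∈ ¬p∈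
  unclash (inj₂ (_ , _ , _ , _ , ψ∈ , n<)) = lose ψ∈ n<

lemma3 : (φ : Formula) → Satisfiable φ →
    Σ CS (λ S → Steps (initial φ) S × Complete S × ClashFree S)
lemma3 φ (M , w , w⊩φ) =
  let (S , steps , complete) , clash-free = outcome-witness (run φ) some-clash-free
  in S , steps , complete , clash-free
  where
  open Realisation M
  some-clash-free : Outcome (ClashFree ∘ proj₁) (run φ)
  some-clash-free = decidable-stable (outcome? (¬? ∘ clash? ∘ proj₁) (run φ))
                                     (unbox (◇-map realised⇒clash-free (run◇ φ w⊩φ)))
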